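{- Let $G$ be a connected graph with $\delta(G)\geq 4$ and let $L(G)$ be its line graph. If $\mathrm{rd}(G)=\mathrm{rvd}(L(G))$, then $\mathrm{rd}(G)=\chi'(G)$.
   Context: $\chi'(G)$ is the chromatic index. The line graph $L(G)$ has vertex set $E(G)$, two edges adjacent iff they share an end. Edge-colorings: a rainbow-cut is an edge-cut whose edges have pairwise distinct colors; $G$ is rainbow disconnected if every two distinct vertices $u,v$ lie in different components of $G-R$ for some rainbow-cut $R$; $\mathrm{rd}(G)$ is the minimum number of colors making $G$ rainbow disconnected. Vertex-colorings of a connected graph $H$: for vertices $x,y$, if nonadjacent an $x$-$y$-vertex-cut is a set $S\subseteq V(H)$ with $x,y$ in different components of $H-S$; if adjacent, a set $S$ with $x,y$ in different components of $(H-xy)-S$. An $x$-$y$-rainbow-vertex-cut is an $x$-$y$-vertex-cut $S$ such that $S$ has pairwise distinct colors if $x,y$ are nonadjacent, and $S\cup\{x\}$ or $S\cup\{y\}$ has pairwise distinct colors if $x,y$ are adjacent. $H$ is rainbow vertex-disconnected if every two vertices $x,y$ have an $x$-$y$-rainbow-vertex-cut; $\mathrm{rvd}(H)$ is the minimum number of colors of a vertex-coloring making $H$ rainbow vertex-disconnected. -}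

module Defs where

open import Data.Nat using (ℕ; _≤_; _<ᵇ_)
open import Data.Bool using (Bool; true; false; T; _∧_)
open import Data.Fin using (Fin; toℕ)
open import Data.List using (length; filterᵇ; allFin)
open import Data.Product using (Σ; ∃; _×_; _,_; proj₁; proj₂)
open import Data.Sum using (_⊎_)
open import Relation.Nullary using (¬_)
open import Relation.Binary.PropositionalEquality using (_≡_; _≢_)
open import Relation.Binary.Construct.Closure.ReflexiveTransitive using (Star)

record Graph : Set where
  field
    n     : ℕ
    adj   : Fin n → Fin n → Bool
    sym   : ∀ u v → adj u v ≡ adj v u
    irref : ∀ u → adj u u ≡ false

module _ (G : Graph) where
  open Graph G

  Vtx : Set
  Vtx = Fin n

  Adj : Vtx → Vtx → Set
  Adj u v = T (adj u v)

  degree : Vtx → ℕ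
  degree u = length (filterᵇ (adj u) (allFin n))

  MinDegree≥ : ℕ → Set
  MinDegree≥ k = ∀ u → k ≤ degree u

  Connected : Set
  Connected = ∀ u v → Star Adj u v

  -- an edge {u,v} is stored once, as the pair (u , v) with u < v
  Edge : Set
  Edge = Σ (Fin n × Fin n) λ p → T ((toℕ (proj₁ p) <ᵇ toℕ (proj₂ p)) ∧ adj (proj₁ p) (proj₂ p))

  end₁ end₂ : Edge → Vtx
  end₁ e = proj₁ (proj₁ e)
  end₂ e = proj₂ (proj₁ e)

  Joins : Edge → Vtx → Vtx → Set
  Joins e a b = (end₁ e ≡ a × end₂ e ≡ b) ⊎ (end₁ e ≡ b × end₂ e ≡ a)

  EdgesAdjacent : Edge → Edge → Set
  EdgesAdjacent e f = e ≢ f ×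
    ((end₁ e ≡ end₁ f ⊎ end₁ e ≡ end₂ f) ⊎ (end₂ e ≡ end₁ f ⊎ end₂ e ≡ end₂ f))

-- Sets of vertices/edges of finite graphs are Bool-valued predicates.
-- Rainbow sets (pairwise distinct colours on a subset)

Rainbow : {V C : Set} → (V → C) → (V → Set) → Set
Rainbow {V} c P = ∀ (a b : V) → P a → P b → c a ≡ c b → a ≡ b

module _ (G : Graph) where

  ProperEdgeColouring : {k : ℕ} → (Edge G → Fin k) → Set
  ProperEdgeColouring c = ∀ e f → EdgesAdjacent G e f → c e ≢ c f

  IsChromaticIndex : ℕ → Set
  IsChromaticIndex k =
    (Σ (Edge G → Fin k) ProperEdgeColouring) ×
    (∀ m → (c : Edge G → Fin m) → ProperEdgeColouring c → k ≤ m)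

  AdjMinus : (Edge G → Bool) → Vtx G → Vtx G → Set
  AdjMinus R a b = Σ (Edge G) λ e → Joins G e a b × ¬ T (R e)

  RainbowDisconnected : {k : ℕ} → (Edge G → Fin k) → Set
  RainbowDisconnected c = ∀ u v → u ≢ v →
    Σ (Edge G → Bool) λ R → Rainbow c (λ e → T (R e)) × ¬ Star (AdjMinus R) u v

  IsRD : ℕ → Set
  IsRD k =
    (Σ (Edge G → Fin k) RainbowDisconnected) ×
    (∀ m → (c : Edge G → Fin m) → RainbowDisconnected c → k ≤ m)

module _ {V : Set} (A : V → V → Set) where

  AdjDel : (V → Bool) → V → V → Set
  AdjDel S a b = A a b × ¬ T (S a) × ¬ T (S b)

  AdjDelEdge : V → V → (V → Bool) → V → V → Set
  AdjDelEdge x y S a b =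
    A a b × ¬ ((a ≡ x × b ≡ y) ⊎ (a ≡ y × b ≡ x)) × ¬ T (S a) × ¬ T (S b)

  Separates : (V → Bool) → V → V → Set
  Separates S x y = ¬ T (S x) × ¬ T (S y) × ¬ Star (AdjDel S) x y

  SeparatesEdge : (V → Bool) → V → V → Set
  SeparatesEdge S x y = ¬ T (S x) × ¬ T (S y) × ¬ Star (AdjDelEdge x y S) x y

  RainbowVertexCut : {C : Set} → (V → C) → V → V → (V → Bool) → Set
  RainbowVertexCut c x y S =
    (¬ A x y → Separates S x y × Rainbow c (λ a → T (S a))) ×
    (A x y → SeparatesEdge S x y ×
       (Rainbow c (λ a → T (S a) ⊎ a ≡ x) ⊎ Rainbow c (λ a → T (S a) ⊎ a ≡ y)))

  RainbowVertexDisconnected : {k : ℕ} → (V → Fin k) → Set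
  RainbowVertexDisconnected c = ∀ x y → x ≢ y →
    Σ (V → Bool) (RainbowVertexCut c x y)

  IsRVD : ℕ → Set
  IsRVD k =
    (Σ (V → Fin k) RainbowVertexDisconnected) ×
    (∀ m → (c : V → Fin m) → RainbowVertexDisconnected c → k ≤ m)

LineAdj : (G : Graph) → Edge G → Edge G → Set
LineAdj G = EdgesAdjacent G

-- A proper edge colouring is rainbow disconnecting: the edges at one end of
-- a pair form a rainbow cut, so rd(G) ≤ χ'(G).  Conversely, let c be a
-- rainbow vertex-disconnecting colouring of L(G) and let e, f share the
-- vertex v.  As deg v ≥ 4 there are two further edges x, y at v; every edge
-- at v other than x and y is a common neighbour of x and y in L(G) − xy, so
-- any x-y-rainbow-vertex-cut contains e and f, whence c e ≠ c f.  Thus c is a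
-- proper edge colouring and χ'(G) ≤ rvd(L(G)) = rd(G).
module Submission where

open import Defs
open import Data.Nat using (ℕ; _≤_; _<_; s≤s⁻¹)
open import Data.Nat.Properties using (<-cmp; <⇒<ᵇ; <ᵇ⇒<; <-irrefl; <-≤-trans; <⇒≤; ≤-antisym)
open import Data.Bool using (Bool; T; T?)
open import Data.Bool.Properties using (T-irrelevant; T-∧)
open import Data.Fin using (Fin; toℕ)
open import Data.Fin.Properties using (toℕ-injective) renaming (_≟_ to _≟ᶠ_)
open import Data.List using (List; []; _∷_; length; filter; filterᵇ; allFin)
open import Data.List.Properties using (filter-notAll)
open import Data.List.Relation.Unary.Any using (here; there)
import Data.List.Relation.Unary.Any as Any
open import Data.List.Relation.Unary.All using (lookup)
open import Data.List.Relation.Unary.AllPairs using (_∷_)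
open import Data.List.Relation.Unary.Unique.Propositional using (Unique)
open import Data.List.Relation.Unary.Unique.Propositional.Properties using (filter⁺; allFin⁺)
open import Data.List.Membership.Propositional.Properties using (∈-filter⁺; ∈-filter⁻)
import Data.List.Membership.DecPropositional as DecMembership
open import Data.Product using (Σ; ∃; ∃₂; _×_; _,_; proj₁; proj₂)
open import Data.Empty using (⊥)
open import Data.Sum using (_⊎_; inj₁; inj₂; [_,_]′)
open import Function using (_∘_; Equivalence)
open import Relation.Binary using (tri<; tri≈; tri>)
open import Relation.Binary.Definitions using (DecidableEquality)
open import Relation.Binary.PropositionalEquality using (_≡_; _≢_; refl; sym; trans; cong; subst)
open import Relation.Binary.Construct.Closure.ReflexiveTransitive using (Star; ε; _◅_)
open import Relation.Nullary using (¬_; Dec; yes; no; ¬?; contradiction)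
open import Relation.Nullary.Decidable using (⌊_⌋; _⊎-dec_; toWitness; fromWitness; decidable-stable)

module _ {A : Set} (_≟_ : DecidableEquality A) where
  open DecMembership _≟_ using (_∈_; _∉_; _∈?_)

  length<⇒∃∈∉ : ∀ {xs ys : List A} → Unique xs → length ys < length xs →
                ∃ λ x → x ∈ xs × x ∉ ys
  length<⇒∃∈∉ {x ∷ xs} {ys} (x≢xs ∷ xs!) |ys|<|x∷xs| with x ∈? ys
  ... | no x∉ys = x , here refl , x∉ys
  ... | yes x∈ys =
    let z , z∈xs , z∉ys-x = length<⇒∃∈∉ xs! |ys-x|<|xs|
    in z , there z∈xs , λ z∈ys → z∉ys-x (∈-filter⁺ ≢x? z∈ys (λ z≡x → lookup x≢xs z∈xs (sym z≡x)))
    where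
    ≢x? = λ y → ¬? (y ≟ x)
    |ys-x|<|xs| : length (filter ≢x? ys) < length xs
    |ys-x|<|xs| = <-≤-trans (filter-notAll ≢x? ys (Any.map (λ x≡y y≢x → y≢x (sym x≡y)) x∈ys))
                            (s≤s⁻¹ |ys|<|x∷xs|)

module _ {V : Set} (A : V → V → Set) where

  commonNeighbour∈cut : ∀ {S x y z} → SeparatesEdge A S x y →
                        A x z → A z y → z ≢ x → z ≢ y → T (S z)
  commonNeighbour∈cut {S} {x} {y} {z} (x∉S , y∉S , x↮y) xz zy z≢x z≢y =
    decidable-stable (T? (S z)) λ z∉S →
      x↮y ((xz , xz≠xy , x∉S , z∉S) ◅ (zy , zy≠xy , z∉S , y∉S) ◅ ε)
    where
    xz≠xy = λ { (inj₁ (_ , z≡y)) → z≢y z≡y ; (inj₂ (_ , z≡x)) → z≢x z≡x }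
    zy≠xy = λ { (inj₁ (z≡x , _)) → z≢x z≡x ; (inj₂ (z≡y , _)) → z≢y z≡y }

module _ (G : Graph) where
  open Graph G using (n; adj; irref) renaming (sym to adj-sym)
  open DecMembership (_≟ᶠ_ {n}) using (_∈_; _∉_)

  neighbours : Vtx G → List (Vtx G)
  neighbours v = filterᵇ (adj v) (allFin n)

  neighbours-unique : ∀ v → Unique (neighbours v)
  neighbours-unique v = filter⁺ (T? ∘ adj v) (allFin⁺ n)

  ∈-neighbours⇒Adj : ∀ {v w} → w ∈ neighbours v → Adj G v w
  ∈-neighbours⇒Adj {v} w∈N = proj₂ (∈-filter⁻ (T? ∘ adj v) {xs = allFin n} w∈N)

  twoFurtherNeighbours : MinDegree≥ G 4 → ∀ v a b → ∃₂ λ w₁ w₂ →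
    Adj G v w₁ × Adj G v w₂ × w₁ ∉ a ∷ b ∷ [] × w₂ ∉ a ∷ b ∷ w₁ ∷ []
  twoFurtherNeighbours δ≥4 v a b
    with w₁ , w₁∈N , w₁∉ab ← length<⇒∃∈∉ _≟ᶠ_ {ys = a ∷ b ∷ []} (neighbours-unique v) (<⇒≤ (δ≥4 v))
    with w₂ , w₂∈N , w₂∉abw₁ ← length<⇒∃∈∉ _≟ᶠ_ {ys = a ∷ b ∷ w₁ ∷ []} (neighbours-unique v) (δ≥4 v)
    = w₁ , w₂ , ∈-neighbours⇒Adj w₁∈N , ∈-neighbours⇒Adj w₂∈N , w₁∉ab , w₂∉abw₁

  edgeBetween : ∀ {v w} → Adj G v w → Σ (Edge G) λ e → Joins G e v w
  edgeBetween {v} {w} vw with <-cmp (toℕ v) (toℕ w)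
  ... | tri< v<w _ _ = ((v , w) , Equivalence.from T-∧ (<⇒<ᵇ v<w , vw)) , inj₁ (refl , refl)
  ... | tri≈ _ v≡w _ = contradiction (subst (Adj G v) (sym (toℕ-injective v≡w)) vw) (subst T (irref v))
  ... | tri> _ _ w<v = ((w , v) , Equivalence.from T-∧ (<⇒<ᵇ w<v , subst T (adj-sym v w) vw)) , inj₂ (refl , refl)

  _≟ᴱ_ : DecidableEquality (Edge G)
  ((a , b) , t) ≟ᴱ ((a′ , b′) , t′) with a ≟ᶠ a′ | b ≟ᶠ b′
  ... | yes refl | yes refl = yes (cong ((a , b) ,_) (T-irrelevant t t′))
  ... | no a≢a′  | _        = no (a≢a′ ∘ cong (end₁ G))
  ... | _        | no b≢b′  = no (b≢b′ ∘ cong (end₂ G))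

  ends-distinct : ∀ e → end₁ G e ≢ end₂ G e
  ends-distinct ((a , b) , t) a≡b =
    <-irrefl (cong toℕ a≡b) (<ᵇ⇒< (toℕ a) (toℕ b) (proj₁ (Equivalence.to T-∧ t)))

  joins-injective : ∀ e {v w w′} → Joins G e v w → Joins G e v w′ → w ≡ w′
  joins-injective _ (inj₁ (_ , p)) (inj₁ (_ , q)) = trans (sym p) q
  joins-injective e (inj₁ (p , _)) (inj₂ (_ , q)) = contradiction (trans p (sym q)) (ends-distinct e)
  joins-injective e (inj₂ (_ , p)) (inj₁ (q , _)) = contradiction (trans q (sym p)) (ends-distinct e)
  joins-injective _ (inj₂ (p , _)) (inj₂ (q , _)) = trans (sym p) q

  Incident : Edge G → Vtx G → Set
  Incident e v = end₁ G e ≡ v ⊎ end₂ G e ≡ v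

  incident? : ∀ e v → Dec (Incident e v)
  incident? e v = (end₁ G e ≟ᶠ v) ⊎-dec (end₂ G e ≟ᶠ v)

  joins⇒incident : ∀ e {v w} → Joins G e v w → Incident e v
  joins⇒incident _ (inj₁ (p , _)) = inj₁ p
  joins⇒incident _ (inj₂ (_ , q)) = inj₂ q

  incident⇒adjacent : ∀ e f {v} → e ≢ f → Incident e v → Incident f v → EdgesAdjacent G e f
  incident⇒adjacent _ _ e≢f (inj₁ p) (inj₁ q) = e≢f , inj₁ (inj₁ (trans p (sym q)))
  incident⇒adjacent _ _ e≢f (inj₁ p) (inj₂ q) = e≢f , inj₁ (inj₂ (trans p (sym q)))
  incident⇒adjacent _ _ e≢f (inj₂ p) (inj₁ q) = e≢f , inj₂ (inj₁ (trans p (sym q)))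
  incident⇒adjacent _ _ e≢f (inj₂ p) (inj₂ q) = e≢f , inj₂ (inj₂ (trans p (sym q)))

  adjacent⇒commonEnd : ∀ {e f} → EdgesAdjacent G e f →
    ∃ λ v → ∃₂ λ a b → Joins G e v a × Joins G f v b
  adjacent⇒commonEnd {e} {f} (_ , inj₁ (inj₁ p)) = end₁ G e , end₂ G e , end₂ G f , inj₁ (refl , refl) , inj₁ (sym p , refl)
  adjacent⇒commonEnd {e} {f} (_ , inj₁ (inj₂ p)) = end₁ G e , end₂ G e , end₁ G f , inj₁ (refl , refl) , inj₂ (refl , sym p)
  adjacent⇒commonEnd {e} {f} (_ , inj₂ (inj₁ p)) = end₂ G e , end₁ G e , end₂ G f , inj₂ (refl , refl) , inj₁ (sym p , refl)
  adjacent⇒commonEnd {e} {f} (_ , inj₂ (inj₂ p)) = end₂ G e , end₁ G e , end₁ G f , inj₂ (refl , refl) , inj₂ (refl , sym p)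

  module _ {k} (c : Edge G → Fin k) where

    proper⇒rainbowDisconnected : ProperEdgeColouring G c → RainbowDisconnected G c
    proper⇒rainbowDisconnected proper u v u≢v = R , rainbow , separated u≢v
      where
      R : Edge G → Bool
      R e = ⌊ incident? e u ⌋

      rainbow : Rainbow c (λ e → T (R e))
      rainbow e f e∈R f∈R ce≡cf with e ≟ᴱ f
      ... | yes e≡f = e≡f
      ... | no e≢f = contradiction ce≡cf
                       (proper e f (incident⇒adjacent e f e≢f (toWitness e∈R) (toWitness f∈R)))

      separated : ∀ {w} → u ≢ w → ¬ Star (AdjMinus G R) u w
      separated u≢w ε = u≢w refl
      separated _ ((e , e-joins , e∉R) ◅ _) = e∉R (fromWitness (joins⇒incident e e-joins))

    edgesAt∈cut : ∀ {S} x y z {v} → SeparatesEdge (LineAdj G) S x y →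
      x ≢ y → Incident x v → Incident y v → Incident z v → z ≢ x → z ≢ y → T (S z)
    edgesAt∈cut x y z sep x≢y xv yv zv z≢x z≢y =
      commonNeighbour∈cut (LineAdj G) sep
        (incident⇒adjacent x z (z≢x ∘ sym) xv zv) (incident⇒adjacent z y z≢y zv yv) z≢x z≢y

    rainbowVertexDisconnected⇒proper : MinDegree≥ G 4 →
      RainbowVertexDisconnected (LineAdj G) c → ProperEdgeColouring G c
    rainbowVertexDisconnected⇒proper δ≥4 rvd e f e~f@(e≢f , _) ce≡cf
      with v , a , b , je , jf ← adjacent⇒commonEnd e~f
      with w₁ , w₂ , vw₁ , vw₂ , w₁∉ab , w₂∉abw₁ ← twoFurtherNeighbours δ≥4 v a b
      with x , jx ← edgeBetween vw₁
      with y , jy ← edgeBetween vw₂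
      = [ ¬rainbow , ¬rainbow ]′ (proj₂ cut)
      where
      xv = joins⇒incident x jx
      yv = joins⇒incident y jy
      x≢y : x ≢ y
      x≢y refl = w₂∉abw₁ (there (there (here (joins-injective y jy jx))))
      e≢x : e ≢ x
      e≢x refl = w₁∉ab (here (joins-injective x jx je))
      e≢y : e ≢ y
      e≢y refl = w₂∉abw₁ (here (joins-injective y jy je))
      f≢x : f ≢ x
      f≢x refl = w₁∉ab (there (here (joins-injective x jx jf)))
      f≢y : f ≢ y
      f≢y refl = w₂∉abw₁ (there (here (joins-injective y jy jf)))
      S = proj₁ (rvd x y x≢y)
      cut = proj₂ (proj₂ (rvd x y x≢y)) (incident⇒adjacent x y x≢y xv yv)
      e∈S = edgesAt∈cut x y e (proj₁ cut) x≢y xv yv (joins⇒incident e je) e≢x e≢y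
      f∈S = edgesAt∈cut x y f (proj₁ cut) x≢y xv yv (joins⇒incident f jf) f≢x f≢y
      ¬rainbow : ∀ {P : Edge G → Set} → Rainbow c (λ g → T (S g) ⊎ P g) → ⊥
      ¬rainbow rainbow = e≢f (rainbow e f (inj₁ e∈S) (inj₁ f∈S) ce≡cf)

theorem4p3 : (G : Graph) → Connected G → MinDegree≥ G 4 →
    (r s χ : ℕ) → IsRD G r → IsRVD (LineAdj G) s → IsChromaticIndex G χ →
    r ≡ s → r ≡ χ
theorem4p3 G _ δ≥4 r s χ (_ , rd-minimal) ((c , c-rvd) , _) ((c′ , c′-proper) , χ-minimal) r≡s =
  ≤-antisym rd≤χ (subst (χ ≤_) (sym r≡s) χ≤rvd)
  where
  rd≤χ : r ≤ χ
  rd≤χ = rd-minimal χ c′ (proper⇒rainbowDisconnected G c′ c′-proper)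
  χ≤rvd : χ ≤ s
  χ≤rvd = χ-minimal s c (rainbowVertexDisconnected⇒proper G c δ≥4 c-rvd)
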